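{- Let $\mathcal{L}$ be a description logic extending $\mathcal{ALCU}$, and let $\rho$ be a rule whose left-hand side $L$ is a tree whose nodes are labelled with (finite sets of) $\mathcal{L}$-concepts and whose edges each carry exactly one label, a basic role. Then $App(\rho)$ can be expressed in $\mathcal{L}$: there is an $\mathcal{L}$-concept $A$ such that for every graph $G$, $G\models A$ if and only if there exists a match from $L$ to $G$.
   Context: $\mathcal{ALC}$ concepts: $C::=\top\mid C_0\mid\exists R.C\mid\neg C\mid C\vee C$ with $C_0$ atomic concepts and $R$ atomic roles; $\mathcal{ALCU}$ adds the universal role $U$ with $U^{\mathcal I}=\Delta\times\Delta$. A graph $G=(N,E,\Phi_N,\Phi_E,s,t)$ (nodes, edges, node labelling by sets of concepts, edge labelling by roles, source, target) induces an interpretation with domain $N$, $C_0^G=\{n\mid C_0\in\Phi_N(n)\}$, $r_0^G=\{(n,m)\mid\exists e.\,s(e)=n,t(e)=m,\Phi_E(e)=r_0\}$, extended to complex concepts in the standard way. A node $n$ satisfies a concept $c$ iff $n\in c^G$; $G\models c$ iff $c^G=N$. A match from $L$ to $G$ is $h=(h^N,h^E)$, $h^N:N^L\to N^G$, $h^E:E^L\to E^G$ with: each $h^N(n)$ satisfies every concept in $\Phi_N^L(n)$; $\Phi_E^G(h^E(e))=\Phi_E^L(e)$; $s^G(h^E(e))=h^N(s^L(e))$; $t^G(h^E(e))=h^N(t^L(e))$. -}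

module Defs where

open import Data.Nat using (ℕ; suc)
open import Data.Fin using (Fin)
open import Data.Bool using (Bool; true; false; not; _∨_)
open import Data.List using (List)
open import Data.List.Relation.Unary.All using (All)
open import Data.Product using (Σ; ∃; _×_; _,_)
open import Relation.Binary.PropositionalEquality using (_≡_; _≢_)
open import Function.Bundles using (_⇔_)

AtomicConcept : Set
AtomicConcept = ℕ

Role : Set
Role = ℕ

-- Nodes are Fin (suc nN): the
-- induced interpretation is a DL interpretation, whose domain is non-empty.
-- Φ_N(n) is a set of atomic concepts, given by its characteristic function.
record Graph : Set where
  field
    nN   : ℕ
    nE   : ℕ
    ΦN   : Fin (suc nN) → AtomicConcept → Bool
    ΦE   : Fin nE → Role
    src  : Fin nE → Fin (suc nN)
    tgt  : Fin nE → Fin (suc nN)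

  Node : Set
  Node = Fin (suc nN)

  Edge : Set
  Edge = Fin nE

open Graph public

record ExtendsALCU : Set₁ where
  field
    Concept : Set
    ⟦_⟧     : Concept → (G : Graph) → Node G → Bool
    ⊤c      : Concept
    atom    : AtomicConcept → Concept
    ¬c_     : Concept → Concept
    _⊔c_    : Concept → Concept → Concept
    ∃[_]c_  : Role → Concept → Concept
    ∃U_     : Concept → Concept
    ⊤-sem    : ∀ G n → ⟦ ⊤c ⟧ G n ≡ true
    atom-sem : ∀ a G n → ⟦ atom a ⟧ G n ≡ ΦN G n a
    ¬-sem    : ∀ C G n → ⟦ ¬c C ⟧ G n ≡ not (⟦ C ⟧ G n)
    ⊔-sem    : ∀ C D G n → ⟦ C ⊔c D ⟧ G n ≡ (⟦ C ⟧ G n ∨ ⟦ D ⟧ G n)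
    ∃-sem    : ∀ r C G n →
               (⟦ ∃[ r ]c C ⟧ G n ≡ true) ⇔
               (Σ (Edge G) λ e → src G e ≡ n × ΦE G e ≡ r × ⟦ C ⟧ G (tgt G e) ≡ true)
    ∃U-sem   : ∀ C G n →
               (⟦ ∃U C ⟧ G n ≡ true) ⇔ (Σ (Node G) λ m → ⟦ C ⟧ G m ≡ true)

module _ (𝓛 : ExtendsALCU) where
  open ExtendsALCU 𝓛

  _⊨at_ : {G : Graph} → Node G → Concept → Set
  _⊨at_ {G} n c = ⟦ c ⟧ G n ≡ true

  _⊨_ : Graph → Concept → Set
  G ⊨ c = ∀ (n : Node G) → ⟦ c ⟧ G n ≡ true

  record LHS : Set where
    field
      kN   : ℕ
      kE   : ℕ
      ΦNL  : Fin kN → List Concept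
      ΦEL  : Fin kE → Role
      srcL : Fin kE → Fin kN
      tgtL : Fin kE → Fin kN

  open LHS public

  data Reach (L : LHS) : Fin (kN L) → Fin (kN L) → Set where
    here : ∀ {a} → Reach L a a
    step : ∀ {a b} (e : Fin (kE L)) → srcL L e ≡ a → Reach L (tgtL L e) b → Reach L a b

  IsTree : LHS → Set
  IsTree L = Σ (Fin (kN L)) λ r →
      (∀ e → tgtL L e ≢ r)
    × (∀ v → v ≢ r → Σ (Fin (kE L)) λ e → tgtL L e ≡ v × (∀ e' → tgtL L e' ≡ v → e' ≡ e))
    × (∀ v → Reach L r v)

  record Match (L : LHS) (G : Graph) : Set where
    field
      hN    : Fin (kN L) → Node G
      hE    : Fin (kE L) → Edge G
      hN-ok : ∀ n → All (λ c → ⟦ c ⟧ G (hN n) ≡ true) (ΦNL L n)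
      hE-lab : ∀ e → ΦE G (hE e) ≡ ΦEL L e
      hE-src : ∀ e → src G (hE e) ≡ hN (srcL L e)
      hE-tgt : ∀ e → tgt G (hE e) ≡ hN (tgtL L e)

-- For a node v of L and a depth k, there is a concept Unfold k v that holds at
-- a node g exactly when the part of L below v, cut off at depth k, matches with
-- v ↦ g: it conjoins the labels of v with ∃R.Unfold (k-1) w for every edge
-- (v, R, w).  Once k exceeds the depth of the tree, Unfold k root describes the
-- whole of L, and A = ∃U.Unfold k root holds everywhere in G iff it holds
-- somewhere (G has a node), i.e. iff some node of G carries a match.  Reading a match off a
-- witness g means walking down the tree from g, following the edges promised
-- by the existential restrictions; because L is a tree, each node of L is
-- reached along a single branch, so the walk assigns it a single image.

module Submission where

open import Axiom.UniquenessOfIdentityProofs using (module Decidable⇒UIP)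
open import Data.Bool using (true; false; not; _∨_; _∧_)
import Data.Bool as Bool
open import Data.Bool.Properties using (not-involutive; ∧-conicalˡ; ∧-conicalʳ)
open import Data.Empty using (⊥-elim)
open import Data.Fin using (Fin; zero)
import Data.Fin as Fin
open import Data.List using (List; []; _∷_; _++_; map; filter; allFin)
open import Data.List.Extrema.Nat using (max; xs≤max)
open import Data.List.Membership.Propositional using (_∈_)
open import Data.List.Membership.Propositional.Properties using (∈-allFin; ∈-filter⁺; ∈-filter⁻)
open import Data.List.Relation.Unary.All as All using (All; []; _∷_)
open import Data.List.Relation.Unary.All.Properties using (++⁺; ++⁻ˡ; ++⁻ʳ; map⁺; map⁻)
open import Data.Nat using (ℕ; zero; suc; _+_; _≤_)
open import Data.Nat.Properties using (m≤n⇒∃[o]m+o≡n; +-suc; suc-injective)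
open import Data.Product using (Σ; _,_; proj₁; proj₂; _×_)
open import Data.Product.Properties using (Σ-≡,≡→≡)
open import Function.Bundles using (_⇔_; mk⇔; Equivalence)
open import Relation.Binary.PropositionalEquality
  using (_≡_; _≢_; refl; sym; trans; cong; cong₂; subst)
open import Relation.Nullary using (Dec)
open import Defs

open Equivalence using (to; from)

not-∨-not : ∀ x y → not (not x ∨ not y) ≡ x ∧ y
not-∨-not false y = refl
not-∨-not true  y = not-involutive y

module _ (𝓛 : ExtendsALCU) where
  open ExtendsALCU 𝓛

  _∣_⊨ᶜ_ : (G : Graph) → Node G → Concept → Set
  G ∣ n ⊨ᶜ c = ⟦ c ⟧ G n ≡ true

  ⊨ᶜ-irrelevant : ∀ {G n c} (p q : G ∣ n ⊨ᶜ c) → p ≡ q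
  ⊨ᶜ-irrelevant = Decidable⇒UIP.≡-irrelevant Bool._≟_

  Witness : (G : Graph) → Concept → Set
  Witness G c = Σ (Node G) λ n → G ∣ n ⊨ᶜ c

  Witness-≡ : ∀ {G c} {w w' : Witness G c} → proj₁ w ≡ proj₁ w' → w ≡ w'
  Witness-≡ refl = Σ-≡,≡→≡ (refl , ⊨ᶜ-irrelevant _ _)

  Successor : (G : Graph) → Node G → Role → Concept → Set
  Successor G n r c = Σ (Edge G) λ ε → src G ε ≡ n × ΦE G ε ≡ r × G ∣ tgt G ε ⊨ᶜ c

  _⊓_ : Concept → Concept → Concept
  c ⊓ d = ¬c ((¬c c) ⊔c (¬c d))

  ⊓-sem : ∀ c d G n → ⟦ c ⊓ d ⟧ G n ≡ ⟦ c ⟧ G n ∧ ⟦ d ⟧ G n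
  ⊓-sem c d G n = trans (¬-sem _ G n)
    (trans (cong not (trans (⊔-sem _ _ G n) (cong₂ _∨_ (¬-sem c G n) (¬-sem d G n))))
           (not-∨-not (⟦ c ⟧ G n) (⟦ d ⟧ G n)))

  ⊨-⊓ : ∀ {G n c d} → G ∣ n ⊨ᶜ (c ⊓ d) ⇔ (G ∣ n ⊨ᶜ c × G ∣ n ⊨ᶜ d)
  ⊨-⊓ {G} {n} {c} {d} = mk⇔
    (λ p → let q = trans (sym (⊓-sem c d G n)) p in ∧-conicalˡ _ _ q , ∧-conicalʳ _ _ q)
    (λ { (p , q) → trans (⊓-sem c d G n) (cong₂ _∧_ p q) })

  ⋀ : List Concept → Concept
  ⋀ []       = ⊤c
  ⋀ (c ∷ cs) = c ⊓ ⋀ cs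

  ⊨-⋀ : ∀ {G n} cs → G ∣ n ⊨ᶜ ⋀ cs ⇔ All (G ∣ n ⊨ᶜ_) cs
  ⊨-⋀ {G} {n} cs = mk⇔ (intro⁻¹ cs) (intro cs)
    where
    intro : ∀ cs → All (G ∣ n ⊨ᶜ_) cs → G ∣ n ⊨ᶜ ⋀ cs
    intro []       []       = ⊤-sem G n
    intro (c ∷ cs) (p ∷ ps) = from ⊨-⊓ (p , intro cs ps)
    intro⁻¹ : ∀ cs → G ∣ n ⊨ᶜ ⋀ cs → All (G ∣ n ⊨ᶜ_) cs
    intro⁻¹ []       _ = []
    intro⁻¹ (c ∷ cs) p = proj₁ (to ⊨-⊓ p) ∷ intro⁻¹ cs (proj₂ (to ⊨-⊓ p))

  ⊨-∃ : ∀ {G n r c} → G ∣ n ⊨ᶜ (∃[ r ]c c) ⇔ Successor G n r c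
  ⊨-∃ {G} {n} {r} {c} = ∃-sem r c G n

  module _ (L : LHS 𝓛) where

    leaves? : ∀ v e → Dec (srcL L e ≡ v)
    leaves? v e = srcL L e Fin.≟ v

    outEdges : Fin (kN L) → List (Fin (kE L))
    outEdges v = filter (leaves? v) (allFin (kE L))

    Unfold : ℕ → Fin (kN L) → Concept
    Unfold zero    v = ⊤c
    Unfold (suc k) v =
      ⋀ (ΦNL L v ++ map (λ e → ∃[ ΦEL L e ]c Unfold k (tgtL L e)) (outEdges v))

    Unfold-labels : ∀ {G g k v} → G ∣ g ⊨ᶜ Unfold (suc k) v → All (G ∣ g ⊨ᶜ_) (ΦNL L v)
    Unfold-labels {v = v} p = ++⁻ˡ (ΦNL L v) (to (⊨-⋀ _) p)

    Unfold-child : ∀ {G g k} e → G ∣ g ⊨ᶜ Unfold (suc k) (srcL L e) →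
                   Successor G g (ΦEL L e) (Unfold k (tgtL L e))
    Unfold-child e p = to ⊨-∃ (All.lookup children (∈-filter⁺ (leaves? _) (∈-allFin e) refl))
      where children = map⁻ (++⁻ʳ (ΦNL L (srcL L e)) (to (⊨-⋀ _) p))

    match⇒Unfold : ∀ {G} (m : Match 𝓛 L G) k v → G ∣ Match.hN m v ⊨ᶜ Unfold k v
    match⇒Unfold {G} m zero    v = ⊤-sem G _
    match⇒Unfold {G} m (suc k) v =
      from (⊨-⋀ _) (++⁺ (hN-ok v) (map⁺ (All.tabulate child)))
      where
      open Match m
      child : ∀ {e} → e ∈ outEdges v → G ∣ hN v ⊨ᶜ (∃[ ΦEL L e ]c Unfold k (tgtL L e))
      child {e} e∈ = from ⊨-∃
        ( hE e
        , trans (hE-src e) (cong hN (proj₂ (∈-filter⁻ (leaves? v) {xs = allFin (kE L)} e∈)))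
        , hE-lab e
        , subst (λ g → G ∣ g ⊨ᶜ Unfold k (tgtL L e)) (sym (hE-tgt e)) (match⇒Unfold m k (tgtL L e)))

    steps : ∀ {a b} → Reach 𝓛 L a b → ℕ
    steps here         = 0
    steps (step _ _ ρ) = suc (steps ρ)

    -- A branch from r to v along which a fuel of D at r drops by one per
    -- edge; the index k is the fuel left at v.
    data Branch (r : Fin (kN L)) (D : ℕ) : ℕ → Fin (kN L) → Set where
      root  : Branch r D D r
      child : ∀ {k v} e → tgtL L e ≡ v → Branch r D (suc k) (srcL L e) → Branch r D k v

    extend : ∀ {r D k a b} (ρ : Reach 𝓛 L a b) → Branch r D (steps ρ + k) a → Branch r D k b
    extend here           β = β
    extend (step e refl ρ) β = extend ρ (child e refl β)

    module _ {r : Fin (kN L)} {D : ℕ} (no-edge-into : ∀ e → tgtL L e ≢ r)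
                   (incoming-unique : ∀ {e e'} → tgtL L e ≡ tgtL L e' → e ≡ e') where

      fuel-unique : ∀ {k k' v} → Branch r D k v → Branch r D k' v → k ≡ k'
      fuel-unique root            root              = refl
      fuel-unique root            (child e' eq' _)  = ⊥-elim (no-edge-into e' eq')
      fuel-unique (child e eq _)  root              = ⊥-elim (no-edge-into e eq)
      fuel-unique (child e eq β) (child e' eq' β') with incoming-unique (trans eq (sym eq'))
      ... | refl = suc-injective (fuel-unique β β')

      module Walk {G} (g₀ : Node G) (g₀⊨ : G ∣ g₀ ⊨ᶜ Unfold D r) where

        walk : ∀ {k v} → Branch r D k v → Witness G (Unfold k v)
        walk root = g₀ , g₀⊨
        walk {k} (child e eq β) =
          let (ε , _ , _ , ε⊨) = Unfold-child {G} {k = k} e (proj₂ (walk β))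
          in tgt G ε , subst (λ w → G ∣ tgt G ε ⊨ᶜ Unfold k w) eq ε⊨

        walk-unique : ∀ {k v} (β β' : Branch r D k v) → walk β ≡ walk β'
        walk-unique root           root             = refl
        walk-unique root           (child e' eq' _) = ⊥-elim (no-edge-into e' eq')
        walk-unique (child e eq _) root             = ⊥-elim (no-edge-into e eq)
        walk-unique {k} (child e eq β) (child e' eq' β') with incoming-unique (trans eq (sym eq'))
        ... | refl = Witness-≡ (cong (λ w → tgt G (proj₁ (Unfold-child {G} {k = k} e (proj₂ w))))
                                    (walk-unique β β'))

        walk-node-unique : ∀ {k k' v} (β : Branch r D k v) (β' : Branch r D k' v) →
                           proj₁ (walk β) ≡ proj₁ (walk β')
        walk-node-unique β β' with fuel-unique β β'
        ... | refl = cong proj₁ (walk-unique β β')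

    module _ (tree : IsTree 𝓛 L) where

      r : Fin (kN L)
      r = proj₁ tree

      no-edge-into-r : ∀ e → tgtL L e ≢ r
      no-edge-into-r = proj₁ (proj₂ tree)

      reachable : ∀ v → Reach 𝓛 L r v
      reachable = proj₂ (proj₂ (proj₂ tree))

      incoming-unique : ∀ {e e'} → tgtL L e ≡ tgtL L e' → e ≡ e'
      incoming-unique {e} {e'} eq =
        let (_ , _ , only-parent) = proj₁ (proj₂ (proj₂ tree)) (tgtL L e') (no-edge-into-r e')
        in trans (only-parent e eq) (sym (only-parent e' refl))

      height : ℕ
      height = max 0 (map (λ v → steps (reachable v)) (allFin (kN L)))

      steps≤height : ∀ v → steps (reachable v) ≤ height
      steps≤height v = All.lookup (map⁻ (xs≤max 0 _)) (∈-allFin v)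

      -- The extra unit of fuel at every node is what makes Unfold pin down its
      -- labels and outgoing edges.
      branch : ∀ v → Σ ℕ λ k → Branch r (suc height) (suc k) v
      branch v =
        let (k , steps+k≡height) = m≤n⇒∃[o]m+o≡n (steps≤height v)
            fuel≡ = trans (+-suc (steps (reachable v)) k) (cong suc steps+k≡height)
        in k , extend (reachable v) (subst (λ n → Branch r (suc height) n r) (sym fuel≡) root)

      treeConcept : Concept
      treeConcept = Unfold (suc height) r

      witness⇒match : ∀ {G} → Witness G treeConcept → Match 𝓛 L G
      witness⇒match {G} (g₀ , g₀⊨) = record
        { hN     = λ v → proj₁ (image v)
        ; hE     = λ e → proj₁ (down e)
        ; hN-ok  = λ v → Unfold-labels {k = fuel v} (proj₂ (image v))
        ; hE-lab = λ e → proj₁ (proj₂ (proj₂ (down e)))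
        ; hE-src = λ e → proj₁ (proj₂ (down e))
        ; hE-tgt = λ e → walk-node-unique
            (child e refl (proj₂ (branch (srcL L e)))) (proj₂ (branch (tgtL L e)))
        }
        where
        open Walk {D = suc height} no-edge-into-r incoming-unique g₀ g₀⊨
        fuel : Fin (kN L) → ℕ
        fuel v = proj₁ (branch v)
        image : ∀ v → Witness G (Unfold (suc (fuel v)) v)
        image v = walk (proj₂ (branch v))
        down : ∀ e → Successor G (proj₁ (image (srcL L e))) (ΦEL L e)
                                 (Unfold (fuel (srcL L e)) (tgtL L e))
        down e = Unfold-child {G} {k = fuel (srcL L e)} e (proj₂ (image (srcL L e)))

mainTheorem5 : (𝓛 : ExtendsALCU) (L : LHS 𝓛) → IsTree 𝓛 L →
    Σ (ExtendsALCU.Concept 𝓛) λ A → ∀ (G : Graph) → (_⊨_ 𝓛 G A ⇔ Match 𝓛 L G)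
mainTheorem5 𝓛 L tree = ∃U treeConcept 𝓛 L tree , λ G → mk⇔
  (λ G⊨A → witness⇒match 𝓛 L tree (to (∃U-sem _ G zero) (G⊨A zero)))
  (λ m n → from (∃U-sem _ G n)
                 (Match.hN m (r 𝓛 L tree) , match⇒Unfold 𝓛 L m (suc (height 𝓛 L tree)) (r 𝓛 L tree)))
  where open ExtendsALCU 𝓛
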